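{- Let $\mathcal G$ be a geodesic on $\mathcal L(A)$ and let $T(\mathcal G)$ be the set of switching pairs in $S(\mathcal G)$. Let $w\in A$ be an alternative that appears in at least one switching pair of $\mathcal G$. Let $H=\{h\in A\setminus\{w\}:(h,w)\in T(\mathcal G)\}$ and $$K_1=\{(a,b)\in T(\mathcal G):\ \exists\, h\in H,\ u\in A\setminus\{h\}\text{ with }(h,u)\in T(\mathcal G),\ (a,b)\trianglelefteq(h,u)\trianglelefteq(h,w),\ \{a,b\}\cap\{h,u\}\neq\emptyset\},$$ and $K_2=T(\mathcal G)\setminus K_1$. Then each switching pair in $K_1$ is disjoint from each switching pair in $K_2$ that appears before it in $S(\mathcal G)$.
   Context: $A$ is a finite set and $\mathcal L(A)$ the set of linear orders on $A$. Two linear orders are alike if one is obtained from the other by swapping two alternatives $x,y$ in adjacent positions; the unordered pair $(x,y)=(y,x)$ is their switching pair. A path $(R_1,\dots,R_k)$ has consecutive orders alike, and $S(\cdot)$ denotes its sequence of switching pairs; a geodesic is a path of minimum length between its endpoints, and in a geodesic each switching pair occurs exactly once. For switching pairs $p,q$ of a geodesic, $p\vartriangleleft q$ means $p$ occurs before $q$ in the sequence, and $p\trianglelefteq q$ means $p\vartriangleleft q$ or $p=q$. Two switching pairs are disjoint if they share no alternative. -}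

module Defs where

open import Data.Nat using (ℕ; _≤_; _<_)
open import Data.Fin using (Fin; toℕ)
open import Data.List using (List; []; _∷_; _++_; length; lookup; allFin)
open import Data.List.Relation.Binary.Permutation.Propositional using (_↭_)
open import Data.Product using (_×_; _,_; ∃; ∃-syntax)
open import Data.Sum using (_⊎_)
open import Relation.Binary.PropositionalEquality using (_≡_; _≢_)
open import Relation.Nullary using (¬_)

-- The finite set A is Fin n.  A linear order on A is represented by the list of
-- its alternatives from best to worst, i.e. a permutation of all of Fin n.
Order : ℕ → Set
Order n = List (Fin n)

IsLinOrd : ∀ {n} → Order n → Set
IsLinOrd {n} R = R ↭ allFin n

-- A switching pair, stored as an ordered pair but always compared as unordered.
Pair : ℕ → Set
Pair n = Fin n × Fin n

_≈P_ : ∀ {n} → Pair n → Pair n → Set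
(a , b) ≈P (c , d) = (a ≡ c × b ≡ d) ⊎ (a ≡ d × b ≡ c)

Alike : ∀ {n} → Order n → Fin n → Fin n → Order n → Set
Alike {n} R x y R' =
  ∃[ pre ] ∃[ post ] (R ≡ pre ++ x ∷ y ∷ post × R' ≡ pre ++ y ∷ x ∷ post)

data Path {n : ℕ} : Order n → Order n → List (Pair n) → Set where
  done : ∀ {R} → Path R R []
  step : ∀ {R R₁ R' x y s} → Alike R x y R₁ → Path R₁ R' s → Path R R' ((x , y) ∷ s)

record Geodesic {n : ℕ} (R R' : Order n) (s : List (Pair n)) : Set where
  field
    startLin : IsLinOrd R
    path     : Path R R' s
    minimal  : ∀ s' → Path R R' s' → length s ≤ length s'

InT : ∀ {n} → Pair n → List (Pair n) → Set
InT p s = ∃[ i ] (lookup s i ≈P p)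

Before : ∀ {n} → List (Pair n) → Pair n → Pair n → Set
Before s p q = ∃[ i ] ∃[ j ] (toℕ i < toℕ j × lookup s i ≈P p × lookup s j ≈P q)

BeforeEq : ∀ {n} → List (Pair n) → Pair n → Pair n → Set
BeforeEq s p q = ∃[ i ] ∃[ j ] (toℕ i ≤ toℕ j × lookup s i ≈P p × lookup s j ≈P q)

Appears : ∀ {n} → Fin n → List (Pair n) → Set
Appears w s = ∃[ x ] (InT (w , x) s)

Meets : ∀ {n} → Pair n → Pair n → Set
Meets (a , b) (c , d) = (a ≡ c ⊎ a ≡ d) ⊎ (b ≡ c ⊎ b ≡ d)

Disjoint : ∀ {n} → Pair n → Pair n → Set
Disjoint p q = ¬ Meets p q

InH : ∀ {n} → List (Pair n) → Fin n → Fin n → Set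
InH s w h = h ≢ w × InT (h , w) s

InK1 : ∀ {n} → List (Pair n) → Fin n → Pair n → Set
InK1 s w p = InT p s ×
  (∃[ h ] ∃[ u ] (InH s w h × u ≢ h × InT (h , u) s ×
     BeforeEq s p (h , u) × BeforeEq s (h , u) (h , w) × Meets p (h , u)))

InK2 : ∀ {n} → List (Pair n) → Fin n → Pair n → Set
InK2 s w p = InT p s × ¬ InK1 s w p

-- Call q ◁ p a backward step if q meets p. Then K₁ is closed under backward steps, which
-- is the theorem. Let p ⊴ (h,u) ⊴ (h,w) witness p ∈ K₁ and write q = (c,d), p = (x,c). If
-- c ∈ {h,u}, the same witnesses serve for q; if x = h, the pair (h,c) = p does. The case
-- x = u needs the geodesic: there each pair is switched exactly once, so the relative
-- order of two alternatives changes exactly when they are switched. Suppose (u,w) and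
-- (c,w) are not switched after (u,c), and (h,c) is not switched between (u,c) and (h,w).
-- At the switch of (h,u), h is adjacent to u. Neither h nor w lies between u and c, as u
-- and c were adjacent just after their switch; neither h nor c lies between u and w, as
-- just after h and u are exchanged neither u nor c lies between h and w, which are
-- adjacent at their own switch. So c and w lie on opposite sides of u, and the neighbour
-- h of u lies between u and one of them: a contradiction.
module Submission where

open import Defs
open import Data.Nat using (ℕ; zero; suc; _≤_; _<_; _≤′_; ≤′-refl; ≤′-step; s≤s)
open import Data.Nat.Properties
  using ( ≤∧≢⇒<; 1+n≢n; 0≢1+n; suc-injective; _≤?_; _<?_; ≤-refl; ≤-trans; ≤-pred
        ; <-trans; <-irrefl; <-cmp; <⇒≤; <⇒≱; n<1+n; n≤1+n; m<n⇒m<1+n; ≤⇒≤′; ≤′⇒≤ )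
open import Data.Fin using (Fin; zero; suc; toℕ; fromℕ<) renaming (_≟_ to _≟ᶠ_)
open import Data.Fin.Properties using (toℕ<n; toℕ-injective; toℕ-fromℕ<; any?)
open import Data.Fin.Permutation.Components using (transpose; transpose-inverse)
open import Data.List using (List; []; _∷_; _++_; map; length; lookup)
open import Data.List.Properties using (map-++; map-cong; map-id-local)
open import Data.List.Membership.Propositional using (_∈_)
open import Data.List.Membership.Propositional.Properties using (∈-allFin)
open import Data.List.Relation.Unary.All as All using (_∷_)
open import Data.List.Relation.Unary.All.Properties using (++⁻ʳ)
import Data.List.Relation.Unary.Any as Any
open import Data.List.Relation.Unary.AllPairs using (_∷_)
open import Data.List.Relation.Unary.Unique.Propositional using (Unique)
open import Data.List.Relation.Unary.Unique.Propositional.Properties using (allFin⁺)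
import Data.List.Relation.Binary.Permutation.Setoid.Properties as ↭ₛ
open import Data.List.Relation.Binary.Permutation.Propositional
  using (↭-sym; ↭-swap; ↭-trans; ↭-refl; ↭⇒↭ₛ)
open import Data.List.Relation.Binary.Permutation.Propositional.Properties using (++⁺ˡ; ∈-resp-↭)
open import Data.Product using (_×_; _,_; proj₁; proj₂; ∃-syntax)
open import Data.Product.Function.NonDependent.Propositional using (_×-⇔_)
open import Data.Sum using (_⊎_; inj₁; inj₂; [_,_])
open import Data.Sum.Function.Propositional using (_⊎-⇔_)
open import Data.Empty using (⊥; ⊥-elim)
open import Function using (_∘_; _⇔_; mk⇔; Injective)
open import Function.Bundles using (module Equivalence)
import Function.Properties.Equivalence as ⇔
open import Relation.Binary.PropositionalEquality
  using ( _≡_; _≢_; refl; sym; trans; cong; cong₂; subst; subst₂; ≢-sym; _≗_; setoid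
        ; module ≡-Reasoning )
open import Relation.Nullary using (¬_; Dec; yes; no)
open import Relation.Nullary.Decidable using (_×-dec_; _⊎-dec_)
open import Relation.Binary using (tri<; tri≈; tri>)

Adjacent : ℕ → ℕ → Set
Adjacent a b = b ≡ suc a ⊎ a ≡ suc b

Adjacent-sym : ∀ {a b} → Adjacent a b → Adjacent b a
Adjacent-sym (inj₁ e) = inj₂ e
Adjacent-sym (inj₂ e) = inj₁ e

Between : ℕ → ℕ → ℕ → Set
Between m a b = (a < m × m < b) ⊎ (b < m × m < a)

Between-subst : ∀ {m a b m' a' b'} → m ≡ m' → a ≡ a' → b ≡ b' →
                Between m a b → Between m' a' b'
Between-subst refl refl refl btw = btw

adjacent⇒¬Between : ∀ {m a b} → Adjacent a b → ¬ Between m a b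
adjacent⇒¬Between (inj₁ refl) (inj₁ (a<m , m<1+a)) = <-irrefl refl (≤-trans m<1+a a<m)
adjacent⇒¬Between {a = a} (inj₁ refl) (inj₂ (1+a<m , m<a)) =
  <-irrefl refl (<-trans m<a (<-trans (n<1+n a) 1+a<m))
adjacent⇒¬Between {b = b} (inj₂ refl) (inj₁ (1+b<m , m<b)) =
  <-irrefl refl (<-trans m<b (<-trans (n<1+n b) 1+b<m))
adjacent⇒¬Between (inj₂ refl) (inj₂ (b<m , m<1+b)) = <-irrefl refl (≤-trans m<1+b b<m)

one-lies-between : ∀ {a b c} → a ≢ b → a ≢ c → b ≢ c →
                   Between a b c ⊎ Between b a c ⊎ Between c a b
one-lies-between {a} {b} {c} a≢b a≢c b≢c with <-cmp a b | <-cmp b c | <-cmp a c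
... | tri≈ _ a≡b _ | _ | _ = ⊥-elim (a≢b a≡b)
... | _ | tri≈ _ b≡c _ | _ = ⊥-elim (b≢c b≡c)
... | _ | _ | tri≈ _ a≡c _ = ⊥-elim (a≢c a≡c)
... | tri< a<b _ _ | tri< b<c _ _ | _ = inj₂ (inj₁ (inj₁ (a<b , b<c)))
... | tri> _ _ b<a | tri> _ _ c<b | _ = inj₂ (inj₁ (inj₂ (c<b , b<a)))
... | tri< _ _ _ | tri> _ _ c<b | tri< a<c _ _ = inj₂ (inj₂ (inj₁ (a<c , c<b)))
... | tri< a<b _ _ | tri> _ _ _ | tri> _ _ c<a = inj₁ (inj₂ (c<a , a<b))
... | tri> _ _ b<a | tri< _ _ _ | tri< a<c _ _ = inj₁ (inj₁ (b<a , a<c))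
... | tri> _ _ b<a | tri< b<c _ _ | tri> _ _ c<a = inj₂ (inj₂ (inj₂ (b<c , c<a)))

neighbour-of-middle-between : ∀ {u h c w} → Adjacent u h → Between u c w → h ≢ c → h ≢ w →
                              Between h u c ⊎ Between h u w
neighbour-of-middle-between {u} (inj₁ refl) (inj₁ (_ , u<w)) _ h≢w =
  inj₂ (inj₁ (n<1+n u , ≤∧≢⇒< u<w h≢w))
neighbour-of-middle-between {h = h} (inj₂ refl) (inj₁ (c<u , _)) h≢c _ =
  inj₁ (inj₂ (≤∧≢⇒< (≤-pred c<u) (≢-sym h≢c) , n<1+n h))
neighbour-of-middle-between {u} (inj₁ refl) (inj₂ (_ , u<c)) h≢c _ =
  inj₁ (inj₁ (n<1+n u , ≤∧≢⇒< u<c h≢c))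
neighbour-of-middle-between {h = h} (inj₂ refl) (inj₂ (w<u , _)) _ h≢w =
  inj₂ (inj₂ (≤∧≢⇒< (≤-pred w<u) (≢-sym h≢w) , n<1+n h))

<-resp-adjacent : ∀ {a a' c} → Adjacent a a' → c ≢ a → c ≢ a' →
                  (a < c ⇔ a' < c) × (c < a ⇔ c < a')
<-resp-adjacent {a} (inj₁ refl) c≢a c≢a' =
  mk⇔ (λ a<c → ≤∧≢⇒< a<c (≢-sym c≢a')) (<-trans (n<1+n a)) ,
  mk⇔ m<n⇒m<1+n (λ c<1+a → ≤∧≢⇒< (≤-pred c<1+a) c≢a)
<-resp-adjacent (inj₂ refl) c≢a c≢a' with <-resp-adjacent (inj₁ refl) c≢a' c≢a
... | left , right = ⇔.sym left , ⇔.sym right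

module _ {n : ℕ} where

  ≈P-refl : ∀ {p : Pair n} → p ≈P p
  ≈P-refl = inj₁ (refl , refl)

  ≈P-sym : ∀ {p q : Pair n} → p ≈P q → q ≈P p
  ≈P-sym (inj₁ (refl , refl)) = inj₁ (refl , refl)
  ≈P-sym (inj₂ (refl , refl)) = inj₂ (refl , refl)

  ≈P-trans : ∀ {p q r : Pair n} → p ≈P q → q ≈P r → p ≈P r
  ≈P-trans (inj₁ (refl , refl)) q≈r = q≈r
  ≈P-trans (inj₂ (refl , refl)) (inj₁ (refl , refl)) = inj₂ (refl , refl)
  ≈P-trans (inj₂ (refl , refl)) (inj₂ (refl , refl)) = inj₁ (refl , refl)

  ≈P-flip : ∀ {p : Pair n} {c d} → p ≈P (c , d) → p ≈P (d , c)
  ≈P-flip (inj₁ e) = inj₂ e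
  ≈P-flip (inj₂ e) = inj₁ e

  _≈P?_ : ∀ (p q : Pair n) → Dec (p ≈P q)
  (a , b) ≈P? (c , d) = (a ≟ᶠ c ×-dec b ≟ᶠ d) ⊎-dec (a ≟ᶠ d ×-dec b ≟ᶠ c)

  Meets-respˡ : ∀ {p p' r : Pair n} → p ≈P p' → Meets p r → Meets p' r
  Meets-respˡ (inj₁ (refl , refl)) m = m
  Meets-respˡ (inj₂ (refl , refl)) (inj₁ m) = inj₂ m
  Meets-respˡ (inj₂ (refl , refl)) (inj₂ m) = inj₁ m

  meets⇒common-point : ∀ {p q : Pair n} → Meets p q →
                       ∃[ c ] ∃[ x ] ∃[ d ] (p ≈P (x , c) × q ≈P (c , d))
  meets⇒common-point {a , b} {e , f} (inj₁ (inj₁ refl)) = a , b , f , ≈P-flip ≈P-refl , ≈P-refl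
  meets⇒common-point {a , b} {e , f} (inj₁ (inj₂ refl)) = a , b , e , ≈P-flip ≈P-refl , ≈P-flip ≈P-refl
  meets⇒common-point {a , b} {e , f} (inj₂ (inj₁ refl)) = b , a , f , ≈P-refl , ≈P-refl
  meets⇒common-point {a , b} {e , f} (inj₂ (inj₂ refl)) = b , a , e , ≈P-refl , ≈P-flip ≈P-refl

  transpose-matchˡ : ∀ (x y : Fin n) → transpose x y x ≡ y
  transpose-matchˡ x y with x ≟ᶠ x
  ... | yes _ = refl
  ... | no x≢x = ⊥-elim (x≢x refl)

  transpose-matchʳ : ∀ (x y : Fin n) → transpose x y y ≡ x
  transpose-matchʳ x y with y ≟ᶠ x
  ... | yes y≡x = y≡x
  ... | no _ with y ≟ᶠ y
  ...   | yes _ = refl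
  ...   | no y≢y = ⊥-elim (y≢y refl)

  transpose-fixes : ∀ {x y z : Fin n} → x ≢ z → y ≢ z → transpose x y z ≡ z
  transpose-fixes {x} {y} {z} x≢z y≢z with z ≟ᶠ x
  ... | yes z≡x = ⊥-elim (x≢z (sym z≡x))
  ... | no _ with z ≟ᶠ y
  ...   | yes z≡y = ⊥-elim (y≢z (sym z≡y))
  ...   | no _ = refl

  transpose-comm : ∀ (x y : Fin n) → transpose x y ≗ transpose y x
  transpose-comm x y z = by-cases (z ≟ᶠ x) (z ≟ᶠ y)
    where
    by-cases : Dec (z ≡ x) → Dec (z ≡ y) → transpose x y z ≡ transpose y x z
    by-cases (yes refl) _ = trans (transpose-matchˡ z y) (sym (transpose-matchʳ y z))
    by-cases (no _) (yes refl) = trans (transpose-matchʳ x z) (sym (transpose-matchˡ z x))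
    by-cases (no z≢x) (no z≢y) =
      trans (transpose-fixes (≢-sym z≢x) (≢-sym z≢y)) (sym (transpose-fixes (≢-sym z≢y) (≢-sym z≢x)))

  transpose-involutive : ∀ (x y : Fin n) → transpose x y ∘ transpose x y ≗ Function.id
  transpose-involutive x y z = trans (cong (transpose x y) (transpose-comm x y z)) (transpose-inverse x y)

  transpose-injective : ∀ (x y : Fin n) → Injective _≡_ _≡_ (transpose x y)
  transpose-injective x y {z} {z'} eq =
    trans (sym (transpose-involutive x y z)) (trans (cong (transpose x y) eq) (transpose-involutive x y z'))

  transpose-≈P : ∀ {x y x' y' : Fin n} → (x , y) ≈P (x' , y') → transpose x y ≗ transpose x' y'
  transpose-≈P (inj₁ (refl , refl)) z = refl
  transpose-≈P (inj₂ (refl , refl)) z = transpose-comm _ _ z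

  transpose-preserves-< : ∀ (Q : Fin n → ℕ) {a b e f} → (∀ {x y} → x ≢ y → Q x ≢ Q y) →
                          Adjacent (Q a) (Q b) → ¬ (a , b) ≈P (e , f) →
                          Q e < Q f ⇔ Q (transpose a b e) < Q (transpose a b f)
  transpose-preserves-< Q {a} {b} {e} {f} Q-inj adj ab≉ef =
    by-cases (e ≟ᶠ a) (e ≟ᶠ b) (f ≟ᶠ a) (f ≟ᶠ b)
    where
    irreflexive : ∀ {x y} → x ≡ y → Q x < Q y ⇔ Q (transpose a b x) < Q (transpose a b y)
    irreflexive refl = mk⇔ (⊥-elim ∘ <-irrefl refl) (⊥-elim ∘ <-irrefl refl)

    by-cases : Dec (e ≡ a) → Dec (e ≡ b) → Dec (f ≡ a) → Dec (f ≡ b) →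
               Q e < Q f ⇔ Q (transpose a b e) < Q (transpose a b f)
    by-cases (yes refl) _ _ (yes refl) = ⊥-elim (ab≉ef ≈P-refl)
    by-cases _ (yes refl) (yes refl) _ = ⊥-elim (ab≉ef (≈P-flip ≈P-refl))
    by-cases (yes refl) _ (yes refl) _ = irreflexive refl
    by-cases _ (yes refl) _ (yes refl) = irreflexive refl
    by-cases (yes refl) _ (no f≢a) (no f≢b)
      rewrite transpose-matchˡ a b | transpose-fixes (≢-sym f≢a) (≢-sym f≢b) =
        proj₁ (<-resp-adjacent adj (Q-inj f≢a) (Q-inj f≢b))
    by-cases (no _) (yes refl) (no f≢a) (no f≢b)
      rewrite transpose-matchʳ a b | transpose-fixes (≢-sym f≢a) (≢-sym f≢b) =
        proj₁ (<-resp-adjacent (Adjacent-sym adj) (Q-inj f≢b) (Q-inj f≢a))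
    by-cases (no e≢a) (no e≢b) (yes refl) _
      rewrite transpose-matchˡ a b | transpose-fixes (≢-sym e≢a) (≢-sym e≢b) =
        proj₂ (<-resp-adjacent adj (Q-inj e≢a) (Q-inj e≢b))
    by-cases (no e≢a) (no e≢b) (no _) (yes refl)
      rewrite transpose-matchʳ a b | transpose-fixes (≢-sym e≢a) (≢-sym e≢b) =
        proj₂ (<-resp-adjacent (Adjacent-sym adj) (Q-inj e≢b) (Q-inj e≢a))
    by-cases (no e≢a) (no e≢b) (no f≢a) (no f≢b)
      rewrite transpose-fixes (≢-sym e≢a) (≢-sym e≢b) | transpose-fixes (≢-sym f≢a) (≢-sym f≢b) =
        ⇔.refl

  pos : Order n → Fin n → ℕ
  pos [] a = 0
  pos (z ∷ L) a with z ≟ᶠ a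
  ... | yes _ = 0
  ... | no _ = suc (pos L a)

  pos-head : ∀ a L → pos (a ∷ L) a ≡ 0
  pos-head a L with a ≟ᶠ a
  ... | yes _ = refl
  ... | no a≢a = ⊥-elim (a≢a refl)

  pos-tail : ∀ {z a} L → z ≢ a → pos (z ∷ L) a ≡ suc (pos L a)
  pos-tail {z} {a} L z≢a with z ≟ᶠ a
  ... | yes z≡a = ⊥-elim (z≢a z≡a)
  ... | no _ = refl

  pos-injective : ∀ {a b} L → a ∈ L → b ∈ L → pos L a ≡ pos L b → a ≡ b
  pos-injective {a} {b} (z ∷ L) a∈ b∈ eq with z ≟ᶠ a | z ≟ᶠ b
  ... | yes refl | yes refl = refl
  ... | yes _ | no _ = ⊥-elim (0≢1+n eq)
  ... | no _ | yes _ = ⊥-elim (0≢1+n (sym eq))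
  ... | no z≢a | no z≢b =
    pos-injective L (Any.tail (≢-sym z≢a) a∈) (Any.tail (≢-sym z≢b) b∈) (suc-injective eq)

  pos-map : ∀ {f : Fin n → Fin n} → Injective _≡_ _≡_ f → ∀ L a → pos (map f L) (f a) ≡ pos L a
  pos-map inj [] a = refl
  pos-map {f} inj (z ∷ L) a with f z ≟ᶠ f a | z ≟ᶠ a
  ... | yes _ | yes _ = refl
  ... | yes fz≡fa | no z≢a = ⊥-elim (z≢a (inj fz≡fa))
  ... | no fz≢fa | yes refl = ⊥-elim (fz≢fa refl)
  ... | no _ | no _ = cong suc (pos-map inj L a)

  pos-adjacent : ∀ pre {x y} post → Unique (pre ++ x ∷ y ∷ post) →
                 Adjacent (pos (pre ++ x ∷ y ∷ post) x) (pos (pre ++ x ∷ y ∷ post) y)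
  pos-adjacent [] {x} {y} post ((x≢y ∷ _) ∷ _) =
    inj₁ (trans (pos-tail (y ∷ post) x≢y)
                (cong suc (trans (pos-head y post) (sym (pos-head x (y ∷ post))))))
  pos-adjacent (z ∷ pre) post (z∉ ∷ u) with ++⁻ʳ pre z∉
  ... | z≢x ∷ z≢y ∷ _ with pos-adjacent pre post u
  ...   | inj₁ e = inj₁ (trans (pos-tail _ z≢y) (trans (cong suc e) (cong suc (sym (pos-tail _ z≢x)))))
  ...   | inj₂ e = inj₂ (trans (pos-tail _ z≢x) (trans (cong suc e) (cong suc (sym (pos-tail _ z≢y)))))

  swap-is-transpose : ∀ pre {x y} post → Unique (pre ++ x ∷ y ∷ post) →
                      map (transpose x y) (pre ++ x ∷ y ∷ post) ≡ pre ++ y ∷ x ∷ post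
  swap-is-transpose [] {x} {y} post ((_ ∷ x∉post) ∷ (y∉post ∷ _)) =
    cong₂ _∷_ (transpose-matchˡ x y) (cong₂ _∷_ (transpose-matchʳ x y)
      (map-id-local (All.zipWith (λ (x≢z , y≢z) → transpose-fixes x≢z y≢z) (x∉post , y∉post))))
  swap-is-transpose (z ∷ pre) post (z∉ ∷ u) with ++⁻ʳ pre z∉
  ... | z≢x ∷ z≢y ∷ _ =
    cong₂ _∷_ (transpose-fixes (≢-sym z≢x) (≢-sym z≢y)) (swap-is-transpose pre post u)

  alike-transpose : ∀ {R R' : Order n} {x y} → Alike R x y R' → Unique R → map (transpose x y) R ≡ R'
  alike-transpose (pre , post , refl , refl) = swap-is-transpose pre post

  alike-adjacent : ∀ {R R' : Order n} {x y} → Alike R x y R' → Unique R → Adjacent (pos R x) (pos R y)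
  alike-adjacent (pre , post , refl , refl) = pos-adjacent pre post

  alike-sym : ∀ {R R' : Order n} {x y} → Alike R x y R' → Alike R' y x R
  alike-sym (pre , post , R≡ , R'≡) = pre , post , R'≡ , R≡

  alike-map : ∀ {R R' : Order n} {x y} (f : Fin n → Fin n) → Alike R x y R' →
              Alike (map f R) (f x) (f y) (map f R')
  alike-map {x = x} {y} f (pre , post , refl , refl) =
    map f pre , map f post , map-++ f pre (x ∷ y ∷ post) , map-++ f pre (y ∷ x ∷ post)

  alike-lin : ∀ {R R' : Order n} {x y} → Alike R x y R' → IsLinOrd R → IsLinOrd R'
  alike-lin {x = x} {y} (pre , post , refl , refl) lin = ↭-trans (++⁺ˡ pre (↭-swap y x ↭-refl)) lin

  lin-unique : ∀ {R : Order n} → IsLinOrd R → Unique R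
  lin-unique lin = ↭ₛ.Unique-resp-↭ (setoid (Fin n)) (↭⇒↭ₛ (↭-sym lin)) (allFin⁺ n)

  lin-∈ : ∀ {R : Order n} → IsLinOrd R → ∀ a → a ∈ R
  lin-∈ lin a = ∈-resp-↭ (↭-sym lin) (∈-allFin a)

  orderAt : ∀ {R R' : Order n} {s} → Path R R' s → ℕ → Order n
  orderAt {R} _ zero = R
  orderAt {R} done (suc t) = R
  orderAt (step _ p) (suc t) = orderAt p t

  orderAt-lin : ∀ {R R' : Order n} {s} → IsLinOrd R → (p : Path R R' s) → ∀ t →
                IsLinOrd (orderAt p t)
  orderAt-lin lin _ zero = lin
  orderAt-lin lin done (suc t) = lin
  orderAt-lin lin (step al p) (suc t) = orderAt-lin (alike-lin al lin) p t

  orderAt-step : ∀ {R R' : Order n} {s} (p : Path R R' s) (i : Fin (length s)) →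
                 Alike (orderAt p (toℕ i)) (proj₁ (lookup s i)) (proj₂ (lookup s i))
                       (orderAt p (suc (toℕ i)))
  orderAt-step (step al p) zero = al
  orderAt-step (step al p) (suc i) = orderAt-step p i

  drop-switch : ∀ {R R' : Order n} {s x y} → IsLinOrd R → Path R R' s → (j : Fin (length s)) →
                lookup s j ≈P (x , y) →
                ∃[ s' ] (Path (map (transpose x y) R) R' s' × length s' < length s)
  drop-switch {R} {R'} lin (step {R₁ = R₁} al p) zero sj≈xy =
    _ , subst (λ L → Path L R' _) R₁≡ p , n<1+n _
    where
    R₁≡ : R₁ ≡ map (transpose _ _) R
    R₁≡ = trans (sym (alike-transpose al (lin-unique lin))) (map-cong (transpose-≈P sj≈xy) R)
  drop-switch {x = x} {y} lin (step al p) (suc j) sj≈xy with drop-switch (alike-lin al lin) p j sj≈xy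
  ... | s' , p' , shorter = _ , step (alike-map (transpose x y) al) p' , s≤s shorter

  repeated-switch-shortcut : ∀ {R R' : Order n} {s} → IsLinOrd R → Path R R' s →
                             ∀ {i j : Fin (length s)} → toℕ i < toℕ j → lookup s i ≈P lookup s j →
                             ∃[ s' ] (Path R R' s' × length s' < length s)
  repeated-switch-shortcut {R} {R'} lin (step {R₁ = R₁} al p) {zero} {suc j} _ si≈sj
    with drop-switch (alike-lin al lin) p j (≈P-flip (≈P-sym si≈sj))
  ... | s' , p' , shorter = s' , subst (λ L → Path L R' s') back p' , m<n⇒m<1+n shorter
    where
    back : map (transpose _ _) R₁ ≡ R
    back = alike-transpose (alike-sym al) (lin-unique (alike-lin al lin))
  repeated-switch-shortcut lin (step al p) {suc i} {suc j} (s≤s i<j) si≈sj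
    with repeated-switch-shortcut (alike-lin al lin) p i<j si≈sj
  ... | s' , p' , shorter = _ , step al p' , s≤s shorter

  K1-intro : ∀ (s : List (Pair n)) {w q h u} (iq j jw : Fin (length s)) → h ≢ w → u ≢ h →
             lookup s iq ≈P q → lookup s j ≈P (h , u) → lookup s jw ≈P (h , w) →
             toℕ iq ≤ toℕ j → toℕ j ≤ toℕ jw → Meets q (h , u) → InK1 s w q
  K1-intro s iq j jw h≢w u≢h siq≈q sj≈hu sjw≈hw iq≤j j≤jw q∩hu =
    (iq , siq≈q) , _ , _ , (h≢w , jw , sjw≈hw) , u≢h , (j , sj≈hu) ,
    (iq , j , iq≤j , siq≈q , sj≈hu) , (j , jw , j≤jw , sj≈hu , sjw≈hw) , q∩hu

module GeodesicProperties {n : ℕ} {R R' : Order n} {s : List (Pair n)} (g : Geodesic R R' s) where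
  open Geodesic g
  open ≡-Reasoning

  no-shorter-path : ¬ (∃[ s' ] (Path R R' s' × length s' < length s))
  no-shorter-path (s' , p' , shorter) = <⇒≱ shorter (minimal s' p')

  switch-index-unique : ∀ {i j : Fin (length s)} {p} → lookup s i ≈P p → lookup s j ≈P p → i ≡ j
  switch-index-unique {i} {j} si≈p sj≈p with <-cmp (toℕ i) (toℕ j)
  ... | tri< i<j _ _ =
    ⊥-elim (no-shorter-path (repeated-switch-shortcut startLin path i<j (≈P-trans si≈p (≈P-sym sj≈p))))
  ... | tri≈ _ i≡j _ = toℕ-injective i≡j
  ... | tri> _ _ j<i =
    ⊥-elim (no-shorter-path (repeated-switch-shortcut startLin path j<i (≈P-trans sj≈p (≈P-sym si≈p))))

  BeforeEq-indices : ∀ {p r} {i j : Fin (length s)} → BeforeEq s p r →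
                     lookup s i ≈P p → lookup s j ≈P r → toℕ i ≤ toℕ j
  BeforeEq-indices (i' , j' , i'≤j' , si'≈p , sj'≈r) si≈p sj≈r
    rewrite switch-index-unique si≈p si'≈p | switch-index-unique sj≈r sj'≈r = i'≤j'

  distinct-switches-ordered : ∀ {i j : Fin (length s)} {p r} → lookup s i ≈P p → lookup s j ≈P r →
                              ¬ p ≈P r → toℕ i ≤ toℕ j → toℕ i < toℕ j
  distinct-switches-ordered si≈p sj≈r p≉r i≤j = ≤∧≢⇒< i≤j λ i≡j →
    p≉r (≈P-trans (≈P-sym si≈p) (subst (λ x → lookup s x ≈P _) (sym (toℕ-injective i≡j)) sj≈r))

  position : ℕ → Fin n → ℕ
  position t = pos (orderAt path t)

  position-injective : ∀ t {a b} → a ≢ b → position t a ≢ position t b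
  position-injective t a≢b eq = a≢b (pos-injective _ (lin-∈ lin _) (lin-∈ lin _) eq)
    where lin = orderAt-lin startLin path t

  switch-transposes : ∀ (i : Fin (length s)) {a b} → lookup s i ≈P (a , b) →
                      ∀ z → position (suc (toℕ i)) z ≡ position (toℕ i) (transpose a b z)
  switch-transposes i {a} {b} si≈ab z = begin
    pos L' z                  ≡⟨ cong (λ M → pos M z) (sym (alike-transpose al (lin-unique lin))) ⟩
    pos (map τ L) z           ≡⟨ cong (pos (map τ L)) (sym (transpose-involutive x y z)) ⟩
    pos (map τ L) (τ (τ z))   ≡⟨ pos-map (transpose-injective x y) L (τ z) ⟩
    pos L (τ z)               ≡⟨ cong (pos L) (transpose-≈P si≈ab z) ⟩
    pos L (transpose a b z)   ∎
    where
    x = proj₁ (lookup s i)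
    y = proj₂ (lookup s i)
    τ = transpose x y
    L = orderAt path (toℕ i)
    L' = orderAt path (suc (toℕ i))
    al = orderAt-step path i
    lin = orderAt-lin startLin path (toℕ i)

  switch-adjacent : ∀ (i : Fin (length s)) {a b} → lookup s i ≈P (a , b) →
                    Adjacent (position (toℕ i) a) (position (toℕ i) b)
  switch-adjacent i (inj₁ (refl , refl)) =
    alike-adjacent (orderAt-step path i) (lin-unique (orderAt-lin startLin path (toℕ i)))
  switch-adjacent i (inj₂ (refl , refl)) =
    Adjacent-sym (alike-adjacent (orderAt-step path i) (lin-unique (orderAt-lin startLin path (toℕ i))))

  switch-swaps : ∀ (i : Fin (length s)) {a b} → lookup s i ≈P (a , b) →
                 position (suc (toℕ i)) a ≡ position (toℕ i) b ×
                 position (suc (toℕ i)) b ≡ position (toℕ i) a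
  switch-swaps i {a} {b} si≈ab =
    trans (switch-transposes i si≈ab a) (cong (position (toℕ i)) (transpose-matchˡ a b)) ,
    trans (switch-transposes i si≈ab b) (cong (position (toℕ i)) (transpose-matchʳ a b))

  switch-fixes : ∀ (i : Fin (length s)) {a b z} → lookup s i ≈P (a , b) → z ≢ a → z ≢ b →
                 position (suc (toℕ i)) z ≡ position (toℕ i) z
  switch-fixes i si≈ab z≢a z≢b =
    trans (switch-transposes i si≈ab _)
          (cong (position (toℕ i)) (transpose-fixes (≢-sym z≢a) (≢-sym z≢b)))

  switch-adjacent-after : ∀ (i : Fin (length s)) {a b} → lookup s i ≈P (a , b) →
                          Adjacent (position (suc (toℕ i)) a) (position (suc (toℕ i)) b)
  switch-adjacent-after i si≈ab with switch-swaps i si≈ab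
  ... | a-moves , b-moves rewrite a-moves | b-moves = Adjacent-sym (switch-adjacent i si≈ab)

  switch-distinct : ∀ (i : Fin (length s)) {a b} → lookup s i ≈P (a , b) → a ≢ b
  switch-distinct i si≈ab refl with switch-adjacent i si≈ab
  ... | inj₁ e = 1+n≢n (sym e)
  ... | inj₂ e = 1+n≢n (sym e)

  order-preserved : ∀ (i : Fin (length s)) {e f} → ¬ lookup s i ≈P (e , f) →
                    position (toℕ i) e < position (toℕ i) f ⇔
                    position (suc (toℕ i)) e < position (suc (toℕ i)) f
  order-preserved i {e} {f} si≉ef =
    subst₂ (λ x y → position (toℕ i) e < position (toℕ i) f ⇔ x < y)
           (sym (switch-transposes i ≈P-refl e)) (sym (switch-transposes i ≈P-refl f))
           (transpose-preserves-< (position (toℕ i)) (position-injective (toℕ i))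
                                  (switch-adjacent i ≈P-refl) si≉ef)

  SwitchedIn : Fin n → Fin n → ℕ → ℕ → Set
  SwitchedIn a b k k' = ∃[ j ] (k ≤ toℕ j × toℕ j < k' × lookup s j ≈P (a , b))

  switchedIn? : ∀ a b k k' → Dec (SwitchedIn a b k k')
  switchedIn? a b k k' = any? λ j → (k ≤? toℕ j) ×-dec (toℕ j <? k') ×-dec (lookup s j ≈P? (a , b))

  SwitchedIn-flip : ∀ {a b k k'} → SwitchedIn a b k k' → SwitchedIn b a k k'
  SwitchedIn-flip (j , k≤j , j<k' , sj≈ab) = j , k≤j , j<k' , ≈P-flip sj≈ab

  SwitchedIn-mono : ∀ {a b k k' l l'} → k ≤ l → l' ≤ k' →
                    SwitchedIn a b l l' → SwitchedIn a b k k'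
  SwitchedIn-mono k≤l l'≤k' (j , l≤j , j<l' , sj≈ab) =
    j , ≤-trans k≤l l≤j , ≤-trans j<l' l'≤k' , sj≈ab

  order-stable : ∀ {e f k k'} → k ≤′ k' → k' ≤ length s → ¬ SwitchedIn e f k k' →
                 position k e < position k f ⇔ position k' e < position k' f
  order-stable ≤′-refl _ _ = ⇔.refl
  order-stable (≤′-step {t} k≤′t) t<len unswitched with fromℕ< t<len | toℕ-fromℕ< t<len
  ... | i | refl =
    ⇔.trans (order-stable k≤′t (<⇒≤ t<len) (unswitched ∘ SwitchedIn-mono ≤-refl (n≤1+n _)))
            (order-preserved i (λ si≈ef → unswitched (i , ≤′⇒≤ k≤′t , ≤-refl , si≈ef)))

  Between-at : ℕ → Fin n → Fin n → Fin n → Set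
  Between-at t m a b = Between (position t m) (position t a) (position t b)

  between-stable : ∀ {m a b k k'} → k ≤ k' → k' ≤ length s →
                   ¬ SwitchedIn m a k k' → ¬ SwitchedIn m b k k' →
                   Between-at k m a b ⇔ Between-at k' m a b
  between-stable {k = k} {k'} k≤k' k'≤len ma-unswitched mb-unswitched =
    (order (ma-unswitched ∘ SwitchedIn-flip) ×-⇔ order mb-unswitched) ⊎-⇔
    (order (mb-unswitched ∘ SwitchedIn-flip) ×-⇔ order ma-unswitched)
    where
    order : ∀ {e f} → ¬ SwitchedIn e f k k' →
            position k e < position k f ⇔ position k' e < position k' f
    order = order-stable (≤⇒≤′ k≤k') k'≤len

  not-between-after : ∀ (i : Fin (length s)) {a b m t} → lookup s i ≈P (a , b) →
                      suc (toℕ i) ≤ t → t ≤ length s →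
                      ¬ SwitchedIn m a (suc (toℕ i)) t → ¬ SwitchedIn m b (suc (toℕ i)) t →
                      ¬ Between-at t m a b
  not-between-after i si≈ab i<t t≤len ma-unswitched mb-unswitched =
    adjacent⇒¬Between (switch-adjacent-after i si≈ab) ∘
    Equivalence.from (between-stable i<t t≤len ma-unswitched mb-unswitched)

  not-between-before : ∀ (k : Fin (length s)) {a b m t} → lookup s k ≈P (a , b) → t ≤ toℕ k →
                       ¬ SwitchedIn m a t (toℕ k) → ¬ SwitchedIn m b t (toℕ k) →
                       ¬ Between-at t m a b
  not-between-before k sk≈ab t≤k ma-unswitched mb-unswitched =
    adjacent⇒¬Between (switch-adjacent k sk≈ab) ∘
    Equivalence.to (between-stable t≤k (<⇒≤ (toℕ<n k)) ma-unswitched mb-unswitched)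

  chain-impossible : ∀ {h u c w} {i j k : Fin (length s)} →
    u ≢ h → c ≢ h → c ≢ u → w ≢ h → w ≢ u → w ≢ c →
    lookup s i ≈P (u , c) → lookup s j ≈P (h , u) → lookup s k ≈P (h , w) →
    toℕ i < toℕ j → toℕ j < toℕ k →
    ¬ SwitchedIn u w (toℕ i) (length s) → ¬ SwitchedIn h c (toℕ i) (suc (toℕ k)) →
    ¬ SwitchedIn c w (toℕ i) (length s) → ⊥
  chain-impossible {h} {u} {c} {w} {i} {j} {k} u≢h c≢h c≢u w≢h w≢u w≢c si≈uc sj≈hu sk≈hw i<j j<k
                   uw-unswitched hc-unswitched cw-unswitched =
    by-middle (one-lies-between (P-inj (≢-sym c≢u)) (P-inj (≢-sym w≢u)) (P-inj (≢-sym w≢c)))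
    where
    t = toℕ j
    P-inj = position-injective t
    t≤len = <⇒≤ (toℕ<n j)
    k≤len = <⇒≤ (toℕ<n k)
    t≤1+k = <⇒≤ (<-trans j<k (n<1+n _))
    i≤1+t = <⇒≤ (<-trans i<j (n<1+n _))

    h-outside-uc : ¬ Between-at t h u c
    h-outside-uc = not-between-after i si≈uc i<j t≤len
      (λ (j' , _ , j'<t , sj'≈hu) → <-irrefl (cong toℕ (switch-index-unique sj'≈hu sj≈hu)) j'<t)
      (hc-unswitched ∘ SwitchedIn-mono (n≤1+n _) t≤1+k)

    w-outside-uc : ¬ Between-at t w u c
    w-outside-uc = not-between-after i si≈uc i<j t≤len
      (uw-unswitched ∘ SwitchedIn-mono (n≤1+n _) t≤len ∘ SwitchedIn-flip)
      (cw-unswitched ∘ SwitchedIn-mono (n≤1+n _) t≤len ∘ SwitchedIn-flip)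

    from-next : ∀ {m m'} → position (suc t) m ≡ position t m' →
                ¬ Between-at (suc t) m h w → ¬ Between (position t m') (position t u) (position t w)
    from-next m-moves not-between =
      not-between ∘ Between-subst (sym m-moves) (sym (proj₁ (switch-swaps j sj≈hu)))
                                  (sym (switch-fixes j sj≈hu w≢h w≢u))

    h-outside-uw : ¬ Between-at t h u w
    h-outside-uw = from-next (proj₂ (switch-swaps j sj≈hu)) (not-between-before k sk≈hw j<k
      (λ (j' , t<j' , _ , sj'≈uh) → <-irrefl (cong toℕ (switch-index-unique sj≈hu (≈P-flip sj'≈uh))) t<j')
      (uw-unswitched ∘ SwitchedIn-mono i≤1+t k≤len))

    c-outside-uw : ¬ Between-at t c u w
    c-outside-uw = from-next (switch-fixes j sj≈hu c≢h c≢u) (not-between-before k sk≈hw j<k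
      (hc-unswitched ∘ SwitchedIn-mono i≤1+t (n≤1+n _) ∘ SwitchedIn-flip)
      (cw-unswitched ∘ SwitchedIn-mono i≤1+t k≤len))

    by-middle : Between-at t u c w ⊎ Between-at t c u w ⊎ Between-at t w u c → ⊥
    by-middle (inj₁ u-middle) =
      [ h-outside-uc , h-outside-uw ]
        (neighbour-of-middle-between (switch-adjacent j (≈P-flip sj≈hu)) u-middle
                                     (P-inj (≢-sym c≢h)) (P-inj (≢-sym w≢h)))
    by-middle (inj₂ (inj₁ c-middle)) = c-outside-uw c-middle
    by-middle (inj₂ (inj₂ w-middle)) = w-outside-uc w-middle

  chain-forces-switch : ∀ {h u c w} {i j k : Fin (length s)} → u ≢ h → c ≢ h → c ≢ u → w ≢ h →
    lookup s i ≈P (u , c) → lookup s j ≈P (h , u) → lookup s k ≈P (h , w) →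
    toℕ i ≤ toℕ j → toℕ j ≤ toℕ k →
    SwitchedIn u w (toℕ i) (length s) ⊎ SwitchedIn h c (toℕ i) (suc (toℕ k)) ⊎
    SwitchedIn c w (toℕ i) (length s)
  chain-forces-switch {h} {u} {c} {w} {i} {j} {k} u≢h c≢h c≢u w≢h si≈uc sj≈hu sk≈hw i≤j j≤k
    with switchedIn? u w (toℕ i) (length s)
       | switchedIn? h c (toℕ i) (suc (toℕ k))
       | switchedIn? c w (toℕ i) (length s)
  ... | yes uw-switched | _ | _ = inj₁ uw-switched
  ... | no _ | yes hc-switched | _ = inj₂ (inj₁ hc-switched)
  ... | no _ | no _ | yes cw-switched = inj₂ (inj₂ cw-switched)
  ... | no uw-unswitched | no hc-unswitched | no cw-unswitched =
    ⊥-elim (chain-impossible u≢h c≢h c≢u w≢h w≢u w≢c si≈uc sj≈hu sk≈hw i<j j<k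
                             uw-unswitched hc-unswitched cw-unswitched)
    where
    switched-at-i : ∀ {a b} → lookup s i ≈P (a , b) → SwitchedIn a b (toℕ i) (length s)
    switched-at-i si≈ab = i , ≤-refl , toℕ<n i , si≈ab

    w≢u : w ≢ u
    w≢u refl = cw-unswitched (switched-at-i (≈P-flip si≈uc))

    w≢c : w ≢ c
    w≢c refl = uw-unswitched (switched-at-i si≈uc)

    i<j : toℕ i < toℕ j
    i<j = distinct-switches-ordered si≈uc sj≈hu
      (λ { (inj₁ (u≡h , _)) → u≢h u≡h ; (inj₂ (_ , c≡h)) → c≢h c≡h }) i≤j

    j<k : toℕ j < toℕ k
    j<k = distinct-switches-ordered sj≈hu sk≈hw
      (λ { (inj₁ (_ , u≡w)) → w≢u (sym u≡w) ; (inj₂ (h≡w , _)) → w≢h (sym h≡w) }) j≤k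

  K1-closed : ∀ w {p q} → InK1 s w p → Before s q p → Meets p q → InK1 s w q
  K1-closed w {q = q}
    (_ , h , u , (h≢w , _) , u≢h , _ ,
         p⊴hu@(_ , j₁ , _ , _ , sj₁≈hu) , hu⊴hw@(_ , j₂ , _ , _ , sj₂≈hw) , p∩hu)
    (iq , ip , iq<ip , siq≈q , sip≈p) p∩q
    with meets⇒common-point p∩q
  ... | c , x , d , p≈xc , q≈cd = by-cases (c ≟ᶠ h) (c ≟ᶠ u) (Meets-respˡ p≈xc p∩hu)
    where
    ip≤j₁ = BeforeEq-indices p⊴hu sip≈p sj₁≈hu
    j₁≤j₂ = BeforeEq-indices hu⊴hw sj₁≈hu sj₂≈hw
    iq≤ip = <⇒≤ iq<ip
    siq≈cd = ≈P-trans siq≈q q≈cd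
    sip≈xc = ≈P-trans sip≈p p≈xc

    meets-first : ∀ {y} → Meets q (c , y)
    meets-first = Meets-respˡ (≈P-sym q≈cd) (inj₁ (inj₁ refl))

    meets-second : ∀ {y} → Meets q (y , c)
    meets-second = Meets-respˡ (≈P-sym q≈cd) (inj₁ (inj₂ refl))

    via-hu : Meets q (h , u) → InK1 s w q
    via-hu = K1-intro s iq j₁ j₂ h≢w u≢h siq≈q sj₁≈hu sj₂≈hw (≤-trans iq≤ip ip≤j₁) j₁≤j₂

    by-cases : Dec (c ≡ h) → Dec (c ≡ u) → (x ≡ h ⊎ x ≡ u) ⊎ (c ≡ h ⊎ c ≡ u) → InK1 s w q
    by-cases (yes refl) _ _ = via-hu meets-first
    by-cases (no _) (yes refl) _ = via-hu meets-second
    by-cases (no c≢h) (no c≢u) (inj₂ c∈hu) = ⊥-elim ([ c≢h , c≢u ] c∈hu)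
    by-cases (no c≢h) (no c≢u) (inj₁ (inj₁ refl)) =
      K1-intro s iq ip j₂ h≢w c≢h siq≈q sip≈xc sj₂≈hw iq≤ip (≤-trans ip≤j₁ j₁≤j₂) meets-second
    -- The switch found gives the new witness (u,c) ⊴ (u,w), (h,c) ⊴ (h,w) or (c,d) ⊴ (c,w).
    by-cases (no c≢h) (no c≢u) (inj₁ (inj₂ refl))
      with chain-forces-switch u≢h c≢h c≢u (≢-sym h≢w) sip≈xc sj₁≈hu sj₂≈hw ip≤j₁ j₁≤j₂
    ... | inj₁ (j , ip≤j , _ , sj≈uw) =
      K1-intro s iq ip j (switch-distinct j sj≈uw) c≢u siq≈q sip≈xc sj≈uw iq≤ip ip≤j meets-second
    ... | inj₂ (inj₁ (j , ip≤j , j<1+j₂ , sj≈hc)) =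
      K1-intro s iq j j₂ h≢w c≢h siq≈q sj≈hc sj₂≈hw (≤-trans iq≤ip ip≤j) (≤-pred j<1+j₂) meets-second
    ... | inj₂ (inj₂ (j , ip≤j , _ , sj≈cw)) =
      K1-intro s iq iq j (switch-distinct j sj≈cw) (≢-sym (switch-distinct iq siq≈cd))
               siq≈q siq≈cd sj≈cw ≤-refl (≤-trans iq≤ip ip≤j) meets-first

lemma13 : ∀ {n : ℕ} {R R' : Order n} {s : List (Pair n)} → Geodesic R R' s →
          (w : Fin n) → Appears w s →
          ∀ p q → InK1 s w p → InK2 s w q → Before s q p → Disjoint p q
lemma13 g w _ p q p∈K₁ (_ , q∉K₁) q◁p p∩q = q∉K₁ (GeodesicProperties.K1-closed g w p∈K₁ q◁p p∩q)
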